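{- Let $G=(V,E,e)$ be a finite connected rooted graph, let $A_n$ be the adjacency matrix of the free power $G^{*n}$, and let $\Delta_n$ be the matrix with $(\Delta_n)_{ij}$ equal to the number of triangles of $G^{*n}$ having $\{i,j\}$ as a side. Then the mixed moments of $A_n^2/n$ and $\Delta_n/n$ with respect to the vacuum state asymptotically vanish: for every finite product $W_n$ of factors each equal to $A_n^2/n$ or $\Delta_n/n$, in which both occur, $\varphi_1(W_n)\to0$ as $n\to\infty$.
   Context: Free power: let $V^0=V\setminus\{e\}$. The vertices of $G^{*n}$ are the empty word (the root, denoted $e$) and all finite words $(v_1,i_1)\cdots(v_m,i_m)$ with $v_r\in V^0$, $i_r\in\{1,\dots,n\}$, $i_r\neq i_{r+1}$. For $i\in\{1,\dots,n\}$, a word $u$ whose first letter (if any) does not have index $i$, and $w\in V$, let $w\cdot_i u$ be $(w,i)u$ if $w\in V^0$ and $u$ if $w=e$; vertices $x,y$ are adjacent iff $x=v\cdot_i u$, $y=v'\cdot_i u$ for some such $i,u$ and some edge $\{v,v'\}\in E$. The vacuum state is $\varphi_1(M)=M_{ee}$. -}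

module Defs where

open import Data.Nat using (ℕ; zero; suc; _+_; _*_; _^_; _≤_; _<_)
open import Data.Bool using (Bool; true; false; if_then_else_; _∧_; not)
open import Data.Fin using (Fin; _≟_)
open import Data.Nat.ListAction using (sum)
open import Data.List using (List; []; _∷_; map; concatMap; filterᵇ; length; _++_; allFin)
open import Data.Product using (_×_; _,_)
open import Relation.Nullary.Decidable using (⌊_⌋)
open import Relation.Binary.PropositionalEquality using (_≡_)

Symmetric : ∀ {m} → (Fin m → Fin m → Bool) → Set
Symmetric adj = ∀ u v → adj u v ≡ adj v u

Irreflexive : ∀ {m} → (Fin m → Fin m → Bool) → Set
Irreflexive adj = ∀ u → adj u u ≡ false

data Reach {m} (adj : Fin m → Fin m → Bool) : Fin m → Fin m → Set where
  here : ∀ {u} → Reach adj u u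
  step : ∀ {u w v} → adj u w ≡ true → Reach adj w v → Reach adj u v

Connected : ∀ {m} → (Fin m → Fin m → Bool) → Set
Connected {m} adj = ∀ (u v : Fin m) → Reach adj u v

adjList : ∀ {m} → (Fin m → Fin m → Bool) → Fin m → List (Fin m)
adjList {m} adj u = filterᵇ (adj u) (allFin m)

-- Free power G^{*n}: vertices are words (v₁,i₁)…(v_k,i_k), v_r ≠ e,
-- i_r ≠ i_{r+1}; the root is the empty word.  Every vertex reachable
-- from the root through `nbrs` is such a reduced word.

Word : ℕ → ℕ → Set
Word m n = List (Fin m × Fin n)

eqFin : ∀ {k} → Fin k → Fin k → Bool
eqFin a b = ⌊ a ≟ b ⌋

eqWord : ∀ {m n} → Word m n → Word m n → Bool
eqWord []             []             = true
eqWord []             (_ ∷ _)        = false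
eqWord (_ ∷ _)        []             = false
eqWord ((v , i) ∷ x) ((w , j) ∷ y) = eqFin v w ∧ eqFin i j ∧ eqWord x y

-- the two kinds of factors: sq stands for A_n², tri for Δ_n
data Factor : Set where
  sq tri : Factor

module FreePower {m : ℕ} (e : Fin m) (adj : Fin m → Fin m → Bool) (n : ℕ) where

  W : Set
  W = Word m n

  dotᵢ : Fin m → Fin n → W → W
  dotᵢ w i u = if eqFin w e then u else ((w , i) ∷ u)

  -- new letters (w', j) with w' ~ e and j different from the first index of x
  -- (decomposition x = e ·ⱼ x)
  grow : W → List W
  grow [] = concatMap (λ j → map (λ w' → (w' , j) ∷ []) (adjList adj e)) (allFin n)
  grow x@((_ , i) ∷ _) =
    concatMap (λ j → map (λ w' → (w' , j) ∷ x) (adjList adj e))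
              (filterᵇ (λ j → not (eqFin i j)) (allFin n))

  -- all neighbours of a vertex of G^{*n} (listed without repetition):
  -- from the decomposition x = w ·ᵢ u (first letter (w,i)) and from the
  -- decompositions x = e ·ⱼ x.
  nbrs : W → List W
  nbrs []            = grow []
  nbrs x@((w , i) ∷ u) = map (λ w' → dotᵢ w' i u) (adjList adj w) ++ grow x

  A : W → W → ℕ
  A x y = length (filterᵇ (eqWord y) (nbrs x))

  -- (Δ_n)_{xy} = number of triangles {x,y,z} of G^{*n} having {x,y} as a side
  Δ : W → W → ℕ
  Δ x y = A x y * sum (map (λ z → A z y) (nbrs x))

  -- col fs x = (M₁ M₂ ⋯ M_k)_{x e}, where fs = [M₁,…,M_k] (each Mᵢ ∈ {A², Δ}).
  -- The (infinite, locally finite) matrix products are computed by summing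
  -- only over the (finite, repetition-free) supports of the rows.
  col : List Factor → W → ℕ
  col []         x = if eqWord x [] then 1 else 0
  col (sq  ∷ fs) x = sum (map (λ z → sum (map (col fs) (nbrs z))) (nbrs x))
  col (tri ∷ fs) x = sum (map (λ y → Δ x y * col fs y) (nbrs x))

  -- unnormalised vacuum moment: φ₁(M₁⋯M_k) = (M₁⋯M_k)_{ee};
  -- the paper's φ₁(W_n) equals this divided by n^(length fs).
  moment : List Factor → ℕ
  moment fs = col fs []

open FreePower public using (moment)

-- In G^{*n} a vertex x of height |x| has O(1) neighbours of height ≤ |x| (inward or lateral
-- steps) and about n neighbours of height |x| + 1 (outward steps); moreover two adjacent vertices
-- have O(1) common neighbours, so Δ_n is entrywise O(1) and supported on edges.  Counting A²
-- as two steps and Δ as one, a walk of L steps from x to the root makes at most ⌊(L − |x|)/2⌋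
-- outward steps, so the x-entry of a product with L steps applied to the root vector is
-- O(n^⌊(L − |x|)/2⌋).  At the root this bounds the unnormalised moment of a product of k factors
-- by O(n^⌊L/2⌋), and a single Δ factor makes ⌊L/2⌋ < k.
module Submission where

open import Defs
open import Data.Nat using (ℕ; suc; _*_; _^_; _≤_; _<_)
open import Data.Fin using (Fin)
open import Data.Bool using (Bool)
open import Data.List using (List; length)
open import Data.List.Membership.Propositional using (_∈_)
open import Data.Product using (∃-syntax)

open import Data.Bool using (true; false)
open import Data.Empty using (⊥-elim)
open import Data.Fin as Fin using (_≟_)
open import Data.List using ([]; _∷_; map; filterᵇ; concatMap; allFin; _++_)
open import Data.List.Properties using (map-++; map-cong; length-tabulate; ∷-injectiveˡ)
open import Data.List.Relation.Unary.All using (All; []; _∷_)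
open import Data.List.Relation.Unary.AllPairs using ([]; _∷_)
open import Data.List.Relation.Unary.Any using (there)
open import Data.List.Relation.Unary.Unique.Propositional using (Unique)
open import Data.List.Relation.Unary.Unique.Propositional.Properties using (allFin⁺)
open import Data.Nat using (_+_; z≤n; s≤s; NonZero; ⌊_/2⌋; ⌈_/2⌉)
open import Data.Nat.ListAction using (sum)
open import Data.Nat.ListAction.Properties using (sum-++)
open import Data.Nat.Properties
  using (≤-refl; ≤-trans; ≤-reflexive; <⇒≢; n≤1+n; m≤n⇒m≤1+n; m≤n+m; m≤m+n;
         +-mono-≤; +-monoʳ-≤; *-mono-≤; *-monoˡ-≤; *-monoʳ-≤; *-monoˡ-<; *-cancelˡ-≤; ^-monoʳ-≤;
         +-suc; +-identityʳ; *-identityʳ; *-identityˡ; *-zeroʳ; *-assoc; *-distribˡ-+; *-distribʳ-+;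
         m^n≢0; ⌊n/2⌋-mono; ⌊n/2⌋≤⌈n/2⌉; *-commutativeSemigroup; module ≤-Reasoning)
open import Data.Nat.Tactic.RingSolver using (solve-∀)
open import Algebra.Properties.CommutativeSemigroup *-commutativeSemigroup using (x∙yz≈y∙xz; xy∙z≈xz∙y)
open import Data.Product using (_,_)
open import Data.Product.Properties using (,-injectiveˡ; ,-injectiveʳ)
open import Data.Sum using (_⊎_; inj₁; inj₂)
open import Function using (_∘_; id)
open import Relation.Binary.Definitions using (DecidableEquality)
open import Relation.Binary.PropositionalEquality
  using (_≡_; _≢_; refl; sym; trans; cong; cong₂; subst; module ≡-Reasoning)
open import Relation.Nullary using (yes; no)
open import Relation.Nullary.Decidable using (⌊_⌋)

𝟙 : Bool → ℕ
𝟙 true  = 1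
𝟙 false = 0

𝟙≤1 : ∀ b → 𝟙 b ≤ 1
𝟙≤1 true  = ≤-refl
𝟙≤1 false = z≤n

𝟙-mono : ∀ {b c} → (b ≡ true → c ≡ true) → 𝟙 b ≤ 𝟙 c
𝟙-mono {false} _   = z≤n
𝟙-mono {true}  b⇒c rewrite b⇒c refl = ≤-refl

sumOver : ∀ {A : Set} → (A → ℕ) → List A → ℕ
sumOver f xs = sum (map f xs)

module _ {A : Set} where

  sumOver-++ : ∀ (f : A → ℕ) xs ys → sumOver f (xs ++ ys) ≡ sumOver f xs + sumOver f ys
  sumOver-++ f xs ys = trans (cong sum (map-++ f xs ys)) (sum-++ (map f xs) (map f ys))

  sumOver-mono : ∀ {f g : A → ℕ} → (∀ a → f a ≤ g a) → ∀ xs → sumOver f xs ≤ sumOver g xs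
  sumOver-mono f≤g []       = z≤n
  sumOver-mono f≤g (x ∷ xs) = +-mono-≤ (f≤g x) (sumOver-mono f≤g xs)

  sumOver-*ˡ : ∀ c (f : A → ℕ) xs → sumOver (λ a → c * f a) xs ≡ c * sumOver f xs
  sumOver-*ˡ c f []       = sym (*-zeroʳ c)
  sumOver-*ˡ c f (x ∷ xs) =
    trans (cong (c * f x +_) (sumOver-*ˡ c f xs)) (sym (*-distribˡ-+ c (f x) _))

  sumOver-*ʳ : ∀ (f : A → ℕ) c xs → sumOver f xs * c ≡ sumOver (λ a → f a * c) xs
  sumOver-*ʳ f c []       = refl
  sumOver-*ʳ f c (x ∷ xs) =
    trans (*-distribʳ-+ c (f x) _) (cong (f x * c +_) (sumOver-*ʳ f c xs))

  sumOver-filterᵇ≤ : ∀ p (f : A → ℕ) xs → sumOver f (filterᵇ p xs) ≤ sumOver f xs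
  sumOver-filterᵇ≤ p f []       = z≤n
  sumOver-filterᵇ≤ p f (x ∷ xs) with p x
  ... | true  = +-monoʳ-≤ (f x) (sumOver-filterᵇ≤ p f xs)
  ... | false = ≤-trans (sumOver-filterᵇ≤ p f xs) (m≤n+m _ (f x))

  sumOver-filterᵇ-bound : ∀ p (f : A → ℕ) B → (∀ a → p a ≡ true → f a ≤ B) →
                          ∀ xs → sumOver f (filterᵇ p xs) ≤ length xs * B
  sumOver-filterᵇ-bound p f B pf≤B []       = z≤n
  sumOver-filterᵇ-bound p f B pf≤B (x ∷ xs) with p x in px
  ... | true  = +-mono-≤ (pf≤B x px) (sumOver-filterᵇ-bound p f B pf≤B xs)
  ... | false = ≤-trans (sumOver-filterᵇ-bound p f B pf≤B xs) (m≤n+m _ B)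

  sumOver-bound : ∀ (f : A → ℕ) B → (∀ a → f a ≤ B) → ∀ xs → sumOver f xs ≤ length xs * B
  sumOver-bound f B f≤B []       = z≤n
  sumOver-bound f B f≤B (x ∷ xs) = +-mono-≤ (f≤B x) (sumOver-bound f B f≤B xs)

  length-filterᵇ : ∀ p (xs : List A) → length (filterᵇ p xs) ≡ sumOver (λ a → 𝟙 (p a)) xs
  length-filterᵇ p []       = refl
  length-filterᵇ p (x ∷ xs) with p x
  ... | true  = cong suc (length-filterᵇ p xs)
  ... | false = length-filterᵇ p xs

  module _ (_≟ᴬ_ : DecidableEquality A) (a : A) where

    count-absent : ∀ {xs} → All (a ≢_) xs → sumOver (λ x → 𝟙 ⌊ a ≟ᴬ x ⌋) xs ≡ 0
    count-absent []         = refl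
    count-absent {x ∷ _} (a≢x ∷ a∉xs) with a ≟ᴬ x
    ... | yes a≡x = ⊥-elim (a≢x a≡x)
    ... | no  _   = count-absent a∉xs

    count-unique : ∀ {xs} → Unique xs → sumOver (λ x → 𝟙 ⌊ a ≟ᴬ x ⌋) xs ≤ 1
    count-unique []                 = z≤n
    count-unique {x ∷ _} (x∉xs ∷ !xs) with a ≟ᴬ x
    ... | no  _    = count-unique !xs
    ... | yes refl = ≤-reflexive (cong suc (count-absent x∉xs))

module _ {A B : Set} where

  sumOver-map : ∀ (f : B → ℕ) (g : A → B) xs → sumOver f (map g xs) ≡ sumOver (λ a → f (g a)) xs
  sumOver-map f g []       = refl
  sumOver-map f g (x ∷ xs) = cong (f (g x) +_) (sumOver-map f g xs)

  sumOver-concatMap : ∀ (f : B → ℕ) (g : A → List B) xs →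
                      sumOver f (concatMap g xs) ≡ sumOver (λ a → sumOver f (g a)) xs
  sumOver-concatMap f g []       = refl
  sumOver-concatMap f g (x ∷ xs) =
    trans (sumOver-++ f (g x) (concatMap g xs)) (cong (sumOver f (g x) +_) (sumOver-concatMap f g xs))

eqFin-sound : ∀ {k} {a b : Fin k} → eqFin a b ≡ true → a ≡ b
eqFin-sound {a = a} {b} eq with a ≟ b
... | yes a≡b = a≡b

eqFin-complete : ∀ {k} {a b : Fin k} → a ≡ b → eqFin a b ≡ true
eqFin-complete {a = a} refl with a ≟ a
... | yes _   = refl
... | no  a≢a = ⊥-elim (a≢a refl)

eqWord-sound : ∀ {m n} {x y : Word m n} → eqWord x y ≡ true → x ≡ y
eqWord-sound {x = []}          {[]}          _  = refl
eqWord-sound {x = (v , i) ∷ x} {(w , j) ∷ y} eq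
  with eqFin v w in v≡w | eqFin i j in i≡j | eqWord x y in x≡y | eq
... | true | true | true | _ =
  cong₂ _∷_ (cong₂ _,_ (eqFin-sound v≡w) (eqFin-sound i≡j)) (eqWord-sound x≡y)

𝟙-eqWord≤ : ∀ {m n} (x y : Word m n) {b} → (x ≡ y → b ≡ true) → 𝟙 (eqWord x y) ≤ 𝟙 b
𝟙-eqWord≤ _ _ x≡y⇒b = 𝟙-mono (x≡y⇒b ∘ eqWord-sound)

adjacent⇒≢ : ∀ {m} {adj : Fin m → Fin m → Bool} → Irreflexive adj →
             ∀ {u v} → adj u v ≡ true → u ≢ v
adjacent⇒≢ irr {u} adj-uu refl with trans (sym adj-uu) (irr u)
... | ()

length-<⇒≢ : ∀ {A : Set} {xs ys : List A} → length xs < length ys → xs ≢ ys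
length-<⇒≢ lt = <⇒≢ lt ∘ cong length

double-* : ∀ m K P → m * (K * P) + m * (K * P) ≡ 2 * m * K * P
double-* = solve-∀

module FreePowerBounds {m : ℕ} (e : Fin m) (adj : Fin m → Fin m → Bool) (n : ℕ) where
  open FreePower e adj n

  -- Every y listed in nbrs x satisfies x ~ y (not conversely: outward steps ignore the
  -- alternation of indices), so a bound over all x ~ y bounds a sum over nbrs x.
  data _~_ : W → W → Set where
    lateral : ∀ {w w' i u} → adj w w' ≡ true → ((w , i) ∷ u) ~ dotᵢ w' i u
    outward : ∀ {w' j x} → adj e w' ≡ true → x ~ ((w' , j) ∷ x)

  dotᵢ-cases : ∀ v i u → dotᵢ v i u ≡ u ⊎ dotᵢ v i u ≡ (v , i) ∷ u
  dotᵢ-cases v i u with eqFin v e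
  ... | true  = inj₁ refl
  ... | false = inj₂ refl

  length-dotᵢ≤ : ∀ v i u → length (dotᵢ v i u) ≤ suc (length u)
  length-dotᵢ≤ v i u with dotᵢ-cases v i u
  ... | inj₁ eq = ≤-trans (≤-reflexive (cong length eq)) (n≤1+n _)
  ... | inj₂ eq = ≤-reflexive (cong length eq)

  sumOver-adjList≤ : ∀ w (f : Fin m → ℕ) B → (∀ {w'} → adj w w' ≡ true → f w' ≤ B) →
                     sumOver f (adjList adj w) ≤ m * B
  sumOver-adjList≤ w f B f≤B =
    subst (λ k → sumOver f (adjList adj w) ≤ k * B) (length-tabulate {n = m} id)
          (sumOver-filterᵇ-bound (adj w) f B (λ _ → f≤B) (allFin m))

  sumOver-nbrs-cons : ∀ (g : W → ℕ) w i u →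
    sumOver g (nbrs ((w , i) ∷ u)) ≡
    sumOver (λ w' → g (dotᵢ w' i u)) (adjList adj w) + sumOver g (grow ((w , i) ∷ u))
  sumOver-nbrs-cons g w i u =
    trans (sumOver-++ g (map (λ w' → dotᵢ w' i u) (adjList adj w)) (grow ((w , i) ∷ u)))
          (cong (_+ sumOver g (grow ((w , i) ∷ u))) (sumOver-map g (λ w' → dotᵢ w' i u) (adjList adj w)))

  sumOver-grow≤ : ∀ (g : W → ℕ) x →
    sumOver g (grow x) ≤ sumOver (λ j → sumOver (λ w' → g ((w' , j) ∷ x)) (adjList adj e)) (allFin n)
  sumOver-grow≤ g [] = ≤-reflexive (begin
    sumOver g (grow [])
      ≡⟨ sumOver-concatMap g _ (allFin n) ⟩
    sumOver (λ j → sumOver g (map (λ w' → (w' , j) ∷ []) (adjList adj e))) (allFin n)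
      ≡⟨ cong sum (map-cong (λ j → sumOver-map g _ (adjList adj e)) (allFin n)) ⟩
    sumOver (λ j → sumOver (λ w' → g ((w' , j) ∷ [])) (adjList adj e)) (allFin n) ∎)
    where open ≡-Reasoning
  sumOver-grow≤ g x@((_ , i) ∷ _) = begin
    sumOver g (grow x)
      ≡⟨ sumOver-concatMap g _ (filterᵇ _ (allFin n)) ⟩
    sumOver (λ j → sumOver g (map (λ w' → (w' , j) ∷ x) (adjList adj e))) (filterᵇ _ (allFin n))
      ≤⟨ sumOver-filterᵇ≤ _ _ (allFin n) ⟩
    sumOver (λ j → sumOver g (map (λ w' → (w' , j) ∷ x) (adjList adj e))) (allFin n)
      ≡⟨ cong sum (map-cong (λ j → sumOver-map g _ (adjList adj e)) (allFin n)) ⟩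
    sumOver (λ j → sumOver (λ w' → g ((w' , j) ∷ x)) (adjList adj e)) (allFin n) ∎
    where open ≤-Reasoning

  sumOver-grow-uniform : ∀ (g : W → ℕ) x b → (∀ {j w'} → adj e w' ≡ true → g ((w' , j) ∷ x) ≤ b) →
                         sumOver g (grow x) ≤ n * (m * b)
  sumOver-grow-uniform g x b g≤b = ≤-trans (sumOver-grow≤ g x)
    (subst (λ k → sumOver (λ j → sumOver (λ w' → g ((w' , j) ∷ x)) (adjList adj e)) (allFin n)
                    ≤ k * (m * b))
           (length-tabulate {n = n} id)
           (sumOver-bound _ (m * b) (λ j → sumOver-adjList≤ e _ b g≤b) (allFin n)))

  sumOver-grow-vanishes : ∀ (g : W → ℕ) x → (∀ {j w'} → adj e w' ≡ true → g ((w' , j) ∷ x) ≤ 0) →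
                          sumOver g (grow x) ≤ 0
  sumOver-grow-vanishes g x g≤0 = ≤-trans (sumOver-grow-uniform g x 0 g≤0)
    (≤-reflexive (trans (cong (n *_) (*-zeroʳ m)) (*-zeroʳ n)))

  sumOver-grow-one-index : ∀ (g : W → ℕ) x c (j₀ : Fin n) →
    (∀ {j w'} → adj e w' ≡ true → g ((w' , j) ∷ x) ≤ c * 𝟙 (eqFin j₀ j)) →
    sumOver g (grow x) ≤ m * c
  sumOver-grow-one-index g x c j₀ g≤ = begin
    sumOver g (grow x)
      ≤⟨ sumOver-grow≤ g x ⟩
    sumOver (λ j → sumOver (λ w' → g ((w' , j) ∷ x)) (adjList adj e)) (allFin n)
      ≤⟨ sumOver-mono (λ j → sumOver-adjList≤ e _ _ g≤) (allFin n) ⟩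
    sumOver (λ j → m * (c * 𝟙 (eqFin j₀ j))) (allFin n)
      ≡⟨ cong sum (map-cong (λ j → sym (*-assoc m c _)) (allFin n)) ⟩
    sumOver (λ j → (m * c) * 𝟙 (eqFin j₀ j)) (allFin n)
      ≡⟨ sumOver-*ˡ (m * c) _ (allFin n) ⟩
    (m * c) * sumOver (λ j → 𝟙 (eqFin j₀ j)) (allFin n)
      ≤⟨ *-monoʳ-≤ (m * c) (count-unique Fin._≟_ j₀ (allFin⁺ n)) ⟩
    (m * c) * 1
      ≡⟨ *-identityʳ (m * c) ⟩
    m * c ∎
    where open ≤-Reasoning

  sumOver-nbrs-cons≤ : ∀ (g : W → ℕ) w i u B C → (∀ w' → g (dotᵢ w' i u) ≤ B) →
    sumOver g (grow ((w , i) ∷ u)) ≤ C → sumOver g (nbrs ((w , i) ∷ u)) ≤ m * B + C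
  sumOver-nbrs-cons≤ g w i u B C g≤B grow≤C = begin
    sumOver g (nbrs ((w , i) ∷ u))
      ≡⟨ sumOver-nbrs-cons g w i u ⟩
    sumOver (λ w' → g (dotᵢ w' i u)) (adjList adj w) + sumOver g (grow ((w , i) ∷ u))
      ≤⟨ +-mono-≤ (sumOver-adjList≤ w _ B (λ {w'} _ → g≤B w')) grow≤C ⟩
    m * B + C ∎
    where open ≤-Reasoning

  A-count : ∀ x y → A x y ≡ sumOver (λ z → 𝟙 (eqWord y z)) (nbrs x)
  A-count x y = length-filterᵇ (eqWord y) (nbrs x)

  count-grow≤ : ∀ x y → sumOver (λ z → 𝟙 (eqWord y z)) (grow x) ≤ m
  count-grow≤ x [] = ≤-trans (sumOver-grow-vanishes _ x (λ _ → z≤n)) z≤n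
  count-grow≤ x ((w , j₀) ∷ y) = ≤-trans
    (sumOver-grow-one-index _ x 1 j₀ (λ {j} _ → ≤-trans
      (𝟙-eqWord≤ ((w , j₀) ∷ y) _ (eqFin-complete ∘ ,-injectiveʳ ∘ ∷-injectiveˡ))
      (≤-reflexive (sym (*-identityˡ _)))))
    (≤-reflexive (*-identityʳ m))

  A≤m+m : ∀ x y → A x y ≤ m + m
  A≤m+m [] y = ≤-trans (≤-reflexive (A-count [] y)) (≤-trans (count-grow≤ [] y) (m≤n+m m m))
  A≤m+m x@((w , i) ∷ u) y = begin
    A x y
      ≡⟨ A-count x y ⟩
    sumOver (λ z → 𝟙 (eqWord y z)) (nbrs x)
      ≤⟨ sumOver-nbrs-cons≤ _ w i u 1 m (λ _ → 𝟙≤1 _) (count-grow≤ x y) ⟩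
    m * 1 + m
      ≡⟨ cong (_+ m) (*-identityʳ m) ⟩
    m + m ∎
    where open ≤-Reasoning

  -- The outward neighbours of (w , j) ∷ x are too long to equal y.
  A-cons≤ : ∀ w j x y B → length y ≤ suc (length x) → (∀ v → 𝟙 (eqWord y (dotᵢ v j x)) ≤ B) →
            A ((w , j) ∷ x) y ≤ m * B
  A-cons≤ w j x y B y-short dot≤B = begin
    A ((w , j) ∷ x) y                        ≡⟨ A-count ((w , j) ∷ x) y ⟩
    sumOver is-y (nbrs ((w , j) ∷ x))        ≤⟨ sumOver-nbrs-cons≤ is-y w j x B 0 dot≤B outward-absent ⟩
    m * B + 0                                ≡⟨ +-identityʳ _ ⟩
    m * B                                    ∎
    where
      open ≤-Reasoning
      is-y : W → ℕ
      is-y z = 𝟙 (eqWord y z)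
      outward-absent : sumOver is-y (grow ((w , j) ∷ x)) ≤ 0
      outward-absent = sumOver-grow-vanishes is-y ((w , j) ∷ x) (λ {j'} {w'} _ →
        𝟙-eqWord≤ y ((w' , j') ∷ (w , j) ∷ x) (⊥-elim ∘ length-<⇒≢ (s≤s y-short)))

  A-sibling≤ : ∀ w' j w'' j' x → A ((w'' , j') ∷ x) ((w' , j) ∷ x) ≤ m * 𝟙 (eqFin j j')
  A-sibling≤ w' j w'' j' x = A-cons≤ w'' j' x _ _ ≤-refl (λ v → 𝟙-eqWord≤ _ _ (same-index v))
    where
      same-index : ∀ v → (w' , j) ∷ x ≡ dotᵢ v j' x → eqFin j j' ≡ true
      same-index v eq with dotᵢ-cases v j' x
      ... | inj₁ dot≡x = ⊥-elim (length-<⇒≢ ≤-refl (sym (trans eq dot≡x)))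
      ... | inj₂ dot≡  = eqFin-complete (,-injectiveʳ (∷-injectiveˡ (trans eq dot≡)))

  lateral≢dotᵢ : Irreflexive adj → ∀ {w w' i u} → adj w w' ≡ true →
                 ∀ v j → dotᵢ w' i u ≢ dotᵢ v j ((w , i) ∷ u)
  lateral≢dotᵢ irr {w} {w'} {i} {u} adj-ww' v j eq with dotᵢ-cases v j ((w , i) ∷ u)
  ... | inj₂ dot≡ = length-<⇒≢ (s≤s (length-dotᵢ≤ w' i u)) (trans eq dot≡)
  ... | inj₁ dot≡ with dotᵢ-cases w' i u
  ...   | inj₁ dot'≡u = length-<⇒≢ ≤-refl (trans (sym dot'≡u) (trans eq dot≡))
  ...   | inj₂ dot'≡  =
    adjacent⇒≢ irr adj-ww' (sym (,-injectiveˡ (∷-injectiveˡ (trans (sym dot'≡) (trans eq dot≡)))))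

  A-outward-lateral≤0 : Irreflexive adj → ∀ {w w' i u} → adj w w' ≡ true →
                        ∀ w'' j → A ((w'' , j) ∷ (w , i) ∷ u) (dotᵢ w' i u) ≤ 0
  A-outward-lateral≤0 irr {w} {w'} {i} {u} adj-ww' w'' j = ≤-trans
    (A-cons≤ w'' j ((w , i) ∷ u) (dotᵢ w' i u) 0 (m≤n⇒m≤1+n (length-dotᵢ≤ w' i u))
       (λ v → 𝟙-eqWord≤ _ _ (⊥-elim ∘ lateral≢dotᵢ irr adj-ww' v j)))
    (≤-reflexive (*-zeroʳ m))

  -- The second factor of Δ x y counts common neighbours of x and y; although degrees grow
  -- with n, adjacent vertices have O(1) of them.
  common-nbrs≤ : Irreflexive adj → ∀ {x y} → x ~ y →
                 sumOver (λ z → A z y) (nbrs x) ≤ m * (m + m) + m * m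
  common-nbrs≤ irr (outward {j = j} {x = []} _) = ≤-trans
    (sumOver-grow-one-index _ [] m j (λ _ → A-sibling≤ _ j _ _ []))
    (m≤n+m _ _)
  common-nbrs≤ irr {y = y} (outward {j = j} {x = (w , i) ∷ u} _) =
    sumOver-nbrs-cons≤ _ w i u (m + m) (m * m) (λ v → A≤m+m (dotᵢ v i u) y)
      (sumOver-grow-one-index _ ((w , i) ∷ u) m j (λ _ → A-sibling≤ _ j _ _ ((w , i) ∷ u)))
  common-nbrs≤ irr {y = y} (lateral {w} {w'} {i} {u} adj-ww') = ≤-trans
    (sumOver-nbrs-cons≤ _ w i u (m + m) 0 (λ v → A≤m+m (dotᵢ v i u) y)
      (sumOver-grow-vanishes _ ((w , i) ∷ u) (λ {j} {w''} _ → A-outward-lateral≤0 irr adj-ww' w'' j)))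
    (+-monoʳ-≤ (m * (m + m)) z≤n)

  Δ-edge≤ : Irreflexive adj → ∀ {x y} → x ~ y → Δ x y ≤ (m + m) * (m * (m + m) + m * m)
  Δ-edge≤ irr {x} {y} x~y = *-mono-≤ (A≤m+m x y) (common-nbrs≤ irr x~y)

  -- g y ≤ K n^⌊(L − |y|)/2⌋, written without division or truncated subtraction.
  Bounded : ℕ → ℕ → (W → ℕ) → W → Set
  Bounded K L g y = g y * n ^ length y ≤ K * n ^ ⌊ L + length y /2⌋

  module _ .{{_ : NonZero n}} (K L : ℕ) (g : W → ℕ) where

    lateral-step : ∀ v i u → Bounded K L g (dotᵢ v i u) →
                   g (dotᵢ v i u) * n ^ suc (length u) ≤ K * n ^ ⌊ suc L + suc (length u) /2⌋
    lateral-step v i u bound with dotᵢ v i u | dotᵢ-cases v i u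
    ... | _ | inj₂ refl =
      ≤-trans bound (*-monoʳ-≤ K (^-monoʳ-≤ n (⌊n/2⌋-mono (n≤1+n (L + suc (length u))))))
    ... | _ | inj₁ refl = begin
      g u * (n * n ^ h)               ≡⟨ x∙yz≈y∙xz (g u) n (n ^ h) ⟩
      n * (g u * n ^ h)               ≤⟨ *-monoʳ-≤ n bound ⟩
      n * (K * n ^ ⌊ L + h /2⌋)       ≡⟨ x∙yz≈y∙xz n K _ ⟩
      K * n ^ ⌊ suc (suc (L + h)) /2⌋ ≡⟨ cong (λ k → K * n ^ ⌊ suc k /2⌋) (sym (+-suc L h)) ⟩
      K * n ^ ⌊ suc L + suc h /2⌋     ∎
      where open ≤-Reasoning
            h = length u

    -- The n choices of an outward index are paid for by the extra factor n in the weight.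
    outward-step : ∀ x → (∀ {j w'} → adj e w' ≡ true → Bounded K L g ((w' , j) ∷ x)) →
                   sumOver g (grow x) * n ^ length x ≤ m * (K * n ^ ⌊ suc L + length x /2⌋)
    outward-step x bound = *-cancelˡ-≤ n (begin
      n * (sumOver g (grow x) * n ^ h)          ≡⟨ x∙yz≈y∙xz n (sumOver g (grow x)) (n ^ h) ⟩
      sumOver g (grow x) * n ^ suc h            ≡⟨ sumOver-*ʳ g _ (grow x) ⟩
      sumOver (λ y → g y * n ^ suc h) (grow x)
        ≤⟨ sumOver-grow-uniform _ x _ (λ adj-ew' → ≤-trans (bound adj-ew') (≤-reflexive P≡)) ⟩
      n * (m * (K * n ^ ⌊ suc L + h /2⌋))       ∎)
      where open ≤-Reasoning
            h = length x
            P≡ : K * n ^ ⌊ L + suc h /2⌋ ≡ K * n ^ ⌊ suc L + h /2⌋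
            P≡ = cong (λ k → K * n ^ ⌊ k /2⌋) (+-suc L h)

    nbrs-Bounded : ∀ x → (∀ {y} → x ~ y → Bounded K L g y) →
                   Bounded (2 * m * K) (suc L) (λ z → sumOver g (nbrs z)) x
    nbrs-Bounded [] bound = begin
      sumOver g (grow []) * 1                 ≤⟨ outward-step [] (bound ∘ outward) ⟩
      m * (K * P)                             ≤⟨ m≤m+n _ _ ⟩
      m * (K * P) + m * (K * P)               ≡⟨ double-* m K P ⟩
      2 * m * K * P                           ∎
      where open ≤-Reasoning
            P = n ^ ⌊ suc L + 0 /2⌋
    nbrs-Bounded x@((w , i) ∷ u) bound = begin
      sumOver g (nbrs x) * n ^ h                   ≡⟨ cong (_* n ^ h) (sumOver-nbrs-cons g w i u) ⟩
      (inner + outer) * n ^ h                      ≡⟨ *-distribʳ-+ (n ^ h) inner outer ⟩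
      inner * n ^ h + outer * n ^ h                ≤⟨ +-mono-≤ inner≤ (outward-step x (bound ∘ outward)) ⟩
      m * (K * P) + m * (K * P)                    ≡⟨ double-* m K P ⟩
      2 * m * K * P                                ∎
      where open ≤-Reasoning
            h = length x
            P = n ^ ⌊ suc L + h /2⌋
            inner = sumOver (λ w' → g (dotᵢ w' i u)) (adjList adj w)
            outer = sumOver g (grow x)
            inner≤ : inner * n ^ h ≤ m * (K * P)
            inner≤ = ≤-trans (≤-reflexive (sumOver-*ʳ _ (n ^ h) (adjList adj w)))
              (sumOver-adjList≤ w _ _ (λ adj-ww' → lateral-step _ i u (bound (lateral adj-ww'))))

steps : List Factor → ℕ
steps []         = 0
steps (sq  ∷ fs) = suc (suc (steps fs))
steps (tri ∷ fs) = suc (steps fs)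

⌈steps/2⌉≤length : ∀ fs → ⌈ steps fs /2⌉ ≤ length fs
⌈steps/2⌉≤length []         = z≤n
⌈steps/2⌉≤length (sq  ∷ fs) = s≤s (⌈steps/2⌉≤length fs)
⌈steps/2⌉≤length (tri ∷ fs) = s≤s (≤-trans (⌊n/2⌋≤⌈n/2⌉ (steps fs)) (⌈steps/2⌉≤length fs))

⌊steps/2⌋<length : ∀ fs → tri ∈ fs → ⌊ steps fs /2⌋ < length fs
⌊steps/2⌋<length (tri ∷ fs) _          = s≤s (⌈steps/2⌉≤length fs)
⌊steps/2⌋<length (sq  ∷ fs) (there p) = s≤s (⌊steps/2⌋<length fs p)

module _ {m : ℕ} (e : Fin m) (adj : Fin m → Fin m → Bool) (irr : Irreflexive adj) where
  open FreePower e adj using (col; Δ; nbrs)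
  open FreePowerBounds e adj using (_~_; Bounded; nbrs-Bounded; Δ-edge≤)

  col-Bounded : ∀ fs → ∃[ K ] (∀ n .{{_ : NonZero n}} x → Bounded n K (steps fs) (col n fs) x)
  col-Bounded [] = 1 , bound
    where bound : ∀ n .{{_ : NonZero n}} x → Bounded n 1 0 (col n []) x
          bound n []      = ≤-refl
          bound n (_ ∷ _) = z≤n
  col-Bounded (sq ∷ fs) with col-Bounded fs
  ... | K , bound = 2 * m * (2 * m * K) , λ n x →
    nbrs-Bounded n (2 * m * K) (suc (steps fs)) (λ z → sumOver (col n fs) (nbrs n z)) x
      (λ {z} _ → nbrs-Bounded n K (steps fs) (col n fs) z (λ {y} _ → bound n y))
  col-Bounded (tri ∷ fs) with col-Bounded fs
  ... | K , bound = 2 * m * (D * K) , λ n x →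
    nbrs-Bounded n (D * K) (steps fs) (λ y → Δ n x y * col n fs y) x (Δ-col-Bounded n x)
    where
      D = (m + m) * (m * (m + m) + m * m)
      Δ-col-Bounded : ∀ n .{{_ : NonZero n}} x {y} → _~_ n x y →
                      Bounded n (D * K) (steps fs) (λ y → Δ n x y * col n fs y) y
      Δ-col-Bounded n x {y} x~y = begin
        Δ n x y * col n fs y * n ^ length y    ≡⟨ *-assoc (Δ n x y) (col n fs y) (n ^ length y) ⟩
        Δ n x y * (col n fs y * n ^ length y)  ≤⟨ *-mono-≤ (Δ-edge≤ n irr x~y) (bound n y) ⟩
        D * (K * P)                            ≡⟨ *-assoc D K P ⟨
        D * K * P                              ∎
        where open ≤-Reasoning
              P = n ^ ⌊ steps fs + length y /2⌋

  moment-bound : ∀ fs → ∃[ K ] (∀ n .{{_ : NonZero n}} → moment e adj n fs ≤ K * n ^ ⌊ steps fs /2⌋)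
  moment-bound fs with col-Bounded fs
  ... | K , bound = K , λ n → begin
    moment e adj n fs                   ≡⟨ *-identityʳ _ ⟨
    moment e adj n fs * 1               ≤⟨ bound n [] ⟩
    K * n ^ ⌊ steps fs + 0 /2⌋          ≡⟨ cong (λ k → K * n ^ ⌊ k /2⌋) (+-identityʳ (steps fs)) ⟩
    K * n ^ ⌊ steps fs /2⌋              ∎
    where open ≤-Reasoning

≤-lower-power⇒< : ∀ {M h k q} C n → M ≤ C * n ^ h → h < k → C * suc q < n → M * suc q < n ^ k
≤-lower-power⇒< {M} {h} {k} {q} C n@(suc _) M≤ h<k C*q<n = begin-strict
  M * suc q              ≤⟨ *-monoˡ-≤ (suc q) M≤ ⟩
  C * n ^ h * suc q      ≡⟨ xy∙z≈xz∙y C (n ^ h) (suc q) ⟩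
  C * suc q * n ^ h      <⟨ *-monoˡ-< (n ^ h) {{m^n≢0 n h}} C*q<n ⟩
  n * n ^ h              ≤⟨ ^-monoʳ-≤ n h<k ⟩
  n ^ k                  ∎
  where open ≤-Reasoning

lemma4p4 : ∀ {m : ℕ} (e : Fin m) (adj : Fin m → Fin m → Bool) →
    Symmetric adj → Irreflexive adj → Connected adj →
    (fs : List Factor) → sq ∈ fs → tri ∈ fs →
    ∀ (q : ℕ) → ∃[ N ] (∀ (n : ℕ) → N ≤ n →
      moment e adj n fs * suc q < n ^ length fs)
lemma4p4 e adj _ irr _ fs _ tri∈fs q with moment-bound e adj irr fs
... | K , bound = suc (K * suc q) , large
  where
    large : ∀ n → suc (K * suc q) ≤ n → moment e adj n fs * suc q < n ^ length fs
    large n@(suc _) N≤n = ≤-lower-power⇒< K n (bound n) (⌊steps/2⌋<length fs tri∈fs) N≤n
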